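{- The class $k\mathrm{STAT}$ consists exactly of the functions $f:\{0,1\}^n\to\{0,1\}$ for which there exist linear forms $L_1,\dots,L_p$ with $p=\mathrm{poly}(n)$, a positive integer $k$, and a labelling function $\mathrm{lab}:\{1,\dots,p\}\to\{0,1\}$ such that for all $\mathbf{x}$, \[ f(\mathbf{x})=1\iff (L_1(\mathbf{x}),\dots,L_p(\mathbf{x}))_{(k)}=L_i(\mathbf{x})\text{ for some } i \text{ with } \mathrm{lab}(i)=1. \] The class $k\mathrm{STAT}_{\mathrm{poly}}$ consists exactly of the functions with the same representation in which the linear forms have coefficients bounded by a polynomial in $n$.
   Context: Linear forms are affine functions of $\mathbf{x}$ (with integer coefficients, without loss of generality). For a vector $\mathbf{z}$, $\mathbf{z}_{(k)}$ denotes its $k$-th smallest entry. $k\mathrm{STAT}$ is the class of (families of) functions $f:\{0,1\}^n\to\{0,1\}$ for which there exist linear forms with integer coefficients $L_1,\dots,L_{\ell_1},R_1,\dots,R_{\ell_2}$ with $\ell_1+\ell_2$ polynomial in $n$, and integers $k_l,k_r$, such that $f(\mathbf{x})=1\iff(L_1(\mathbf{x}),\dots,L_{\ell_1}(\mathbf{x}))_{(k_l)}<(R_1(\mathbf{x}),\dots,R_{\ell_2}(\mathbf{x}))_{(k_r)}$. $k\mathrm{STAT}_{\mathrm{poly}}$ is the subclass where all coefficients are bounded in absolute value by a polynomial in $n$. -}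

module Defs where

open import Data.Bool using (Bool; true; false; if_then_else_)
open import Data.Nat using (ℕ; zero; suc; _^_) renaming (_*_ to _*ℕ_; _+_ to _+ℕ_; _≤_ to _≤ℕ_)
open import Data.Integer using (ℤ; +_; _+_; _*_; _<_; ∣_∣)
open import Data.Integer.Properties using (≤-decTotalOrder)
open import Data.Fin using (Fin; zero; suc)
open import Data.List using (List; []; _∷_; tabulate)
open import Data.List.Sort ≤-decTotalOrder using (sort)
open import Data.Product using (Σ; _×_; _,_; ∃)
open import Data.Unit using (⊤)
open import Relation.Binary.PropositionalEquality using (_≡_)
open import Function.Bundles using (_⇔_)

Input : ℕ → Set
Input n = Fin n → Bool

Family : Set
Family = (n : ℕ) → Input n → Bool

record LinForm (n : ℕ) : Set where
  constructor linForm
  field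
    coeff : Fin n → ℤ
    const : ℤ
open LinForm public

bit : Bool → ℤ
bit true  = + 1
bit false = + 0

sumFin : (n : ℕ) → (Fin n → ℤ) → ℤ
sumFin zero    f = + 0
sumFin (suc n) f = f zero + sumFin n (λ i → f (suc i))

eval : {n : ℕ} → LinForm n → Input n → ℤ
eval {n} L x = const L + sumFin n (λ i → coeff L i * bit (x i))

CoeffBounded : {n : ℕ} → ℕ → LinForm n → Set
CoeffBounded B L = ((i : _) → ∣ coeff L i ∣ ≤ℕ B) × (∣ const L ∣ ≤ℕ B)

-- Polynomial bound  c · n^c + c  (every polynomial is dominated by one of these).
poly : ℕ → ℕ → ℕ
poly c n = c *ℕ (n ^ c) +ℕ c

values : {n p : ℕ} → (Fin p → LinForm n) → Input n → List ℤ
values L x = tabulate (λ i → eval (L i) x)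

-- 1-based indexing into a list (default 0 when out of range; the
-- definitions below always require 1 ≤ k ≤ length).
index1 : List ℤ → ℕ → ℤ
index1 []       _             = + 0
index1 (z ∷ zs) zero          = + 0
index1 (z ∷ zs) (suc zero)    = z
index1 (z ∷ zs) (suc (suc k)) = index1 zs (suc k)

kth : List ℤ → ℕ → ℤ
kth zs k = index1 (sort zs) k

-- kSTAT-type representation at input length n, where every linear form
-- must satisfy the predicate Ok (⊤ for kSTAT, a coefficient bound for
-- kSTAT_poly), and the total number of forms is at most P.

KStatRep : (n : ℕ) → (LinForm n → Set) → ℕ → (Input n → Bool) → Set
KStatRep n Ok P f =
  Σ ℕ λ ℓ₁ → Σ ℕ λ ℓ₂ → (ℓ₁ +ℕ ℓ₂ ≤ℕ P) ×
  Σ (Fin ℓ₁ → LinForm n) λ L → Σ (Fin ℓ₂ → LinForm n) λ R →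
  ((i : Fin ℓ₁) → Ok (L i)) × ((j : Fin ℓ₂) → Ok (R j)) ×
  Σ ℕ λ kₗ → Σ ℕ λ kᵣ →
  (1 ≤ℕ kₗ) × (kₗ ≤ℕ ℓ₁) × (1 ≤ℕ kᵣ) × (kᵣ ≤ℕ ℓ₂) ×
  ((x : Input n) →
     (f x ≡ true) ⇔ (kth (values L x) kₗ < kth (values R x) kᵣ))

LabRep : (n : ℕ) → (LinForm n → Set) → ℕ → (Input n → Bool) → Set
LabRep n Ok P f =
  Σ ℕ λ p → (p ≤ℕ P) ×
  Σ (Fin p → LinForm n) λ L → ((i : Fin p) → Ok (L i)) ×
  Σ ℕ λ k → (1 ≤ℕ k) × (k ≤ℕ p) ×
  Σ (Fin p → Bool) λ lab →
  ((x : Input n) →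
     (f x ≡ true) ⇔
       (Σ (Fin p) λ i → (lab i ≡ true) × (kth (values L x) k ≡ eval (L i) x)))

kSTAT : Family → Set
kSTAT F = Σ ℕ λ c → (n : ℕ) → KStatRep n (λ _ → ⊤) (poly c n) (F n)

kSTATpoly : Family → Set
kSTATpoly F = Σ ℕ λ c → Σ ℕ λ d →
  (n : ℕ) → KStatRep n (CoeffBounded (poly d n)) (poly c n) (F n)

kSTATlab : Family → Set
kSTATlab F = Σ ℕ λ c → (n : ℕ) → LabRep n (λ _ → ⊤) (poly c n) (F n)

kSTATlabPoly : Family → Set
kSTATlabPoly F = Σ ℕ λ c → Σ ℕ λ d →
  (n : ℕ) → LabRep n (CoeffBounded (poly d n)) (poly c n) (F n)

-- Perturb the forms to p·L_i + i: ties are broken, and the order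
-- statistic L_(r+1) is attained by a pivot i* whose key has rank exactly r. Given rows of auxiliary
-- forms e_{i,c} with |e_{i,c}| ≤ H, the forms M·(p·L_i + i) + e_{i,c} with M = 2H + 1 sort
-- lexicographically, so their (rW + q)-th smallest value is M·(p·L_{i*} + i*) plus the q-th smallest
-- entry of the pivot row: a question about the pivot becomes a single order statistic.
-- kSTAT ⇒ labelled: row i holds R_j − L_i − 1 for every j and b labelled zeros. Its b-th smallest
-- entry is 0 iff fewer than b of the R_j are ≤ L_{i*}, i.e. iff L_(r+1) < R_(b).
-- labelled ⇒ kSTAT: row i holds, for each j, the pair L_i − L_j, L_j − L_i if j is labelled and the
-- pair 1, 0 otherwise. Every pair has an entry ≤ 0, and both are ≤ 0 iff j is labelled with
-- L_j = L_{i*}; so the (p+1)-th smallest entry of the pivot row lies below 1 (the single entry of a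
-- second, constant block) iff L_(r+1) is the value of a labelled form.
-- All coefficients stay polynomially bounded; for plain kSTAT the construction is run with the largest
-- coefficient that occurs.

module Submission where

open import Defs
open import Data.Bool as Bool using (Bool; true; false)
open import Data.Empty using (⊥-elim)
open import Data.Fin as Fin using (Fin; zero; suc; toℕ; _↑ˡ_; _↑ʳ_; splitAt; remQuot; combine)
import Data.Fin.Properties as Finₚ
open import Data.Integer as ℤ using (ℤ; +_; -_; _+_; _-_; _*_; _<_; _≤_; _<?_; _≤?_; ∣_∣; +<+; +≤+; -≤+; -1ℤ; 0ℤ; 1ℤ)
import Data.Integer.Properties as ℤₚ
open import Data.Integer.Tactic.RingSolver using () renaming (solve-∀ to solve-∀-ℤ)
open import Data.List using (_∷_; tabulate; length; filter)
import Data.List.Properties as Listₚ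
open import Data.List.Membership.Propositional using (_∈_)
open import Data.List.Membership.Propositional.Properties using (∈-tabulate⁻)
open import Data.List.Relation.Unary.Any using (here; there)
import Data.List.Relation.Unary.All as All
open import Data.List.Relation.Unary.Linked as Linked using (Linked)
import Data.List.Relation.Unary.Linked.Properties as Linkedₚ
open import Data.List.Relation.Binary.Permutation.Propositional.Properties using (filter-↭; ↭-length; ∈-resp-↭)
open import Data.List.Sort ℤₚ.≤-decTotalOrder using (sort; sort-↭; sort-↗)
open import Data.Nat as ℕ using (ℕ; zero; suc; z≤n; s≤s; _^_; _⊔_)
  renaming (_+_ to _+ℕ_; _*_ to _*ℕ_; _≤_ to _≤ℕ_; _<_ to _<ℕ_)
import Data.Nat.Properties as ℕₚ
open import Data.Nat.Tactic.RingSolver using (solve-∀)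
open import Data.Product using (Σ; ∃; _×_; _,_; proj₁; proj₂)
open import Data.Sum using (_⊎_; inj₁; inj₂)
open import Data.Unit using (tt)
open import Function using (_∘_)
open import Function.Bundles using (_⇔_; mk⇔; Equivalence)
open import Function.Properties.Equivalence using (⇔-setoid)
open import Level using (0ℓ)
open import Relation.Nullary using (Dec; yes; no; ¬_; _×-dec_)
open import Relation.Binary.Definitions using (tri<; tri≈; tri>)
open import Relation.Binary.PropositionalEquality
  using (_≡_; refl; sym; trans; cong; cong₂; subst; subst₂; module ≡-Reasoning)
import Relation.Binary.Reasoning.Setoid

open import Algebra.Properties.AbelianGroup ℤₚ.+-0-abelianGroup using (\\-leftDividesʳ; //-rightDividesˡ; //-rightDividesʳ; ∙-cancelˡ)
open import Algebra.Properties.CommutativeSemigroup ℤₚ.+-commutativeSemigroup using (interchange)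
open import Algebra.Properties.Semiring.Sum ℕₚ.+-*-semiring
  using (sum; sum-syntax; ∑-distrib-+; sum-cong-≗; sum-replicate-zero; *-distribʳ-sum)


-- Counting

𝟙 : {A : Set} → Dec A → ℕ
𝟙 (yes _) = 1
𝟙 (no _)  = 0

𝟙≤1 : {A : Set} (a? : Dec A) → 𝟙 a? ≤ℕ 1
𝟙≤1 (yes _) = s≤s z≤n
𝟙≤1 (no _)  = z≤n

𝟙-yes : {A : Set} (a? : Dec A) → A → 𝟙 a? ≡ 1
𝟙-yes (yes _) _ = refl
𝟙-yes (no ¬a) a = ⊥-elim (¬a a)

𝟙-no : {A : Set} (a? : Dec A) → ¬ A → 𝟙 a? ≡ 0
𝟙-no (yes a) ¬a = ⊥-elim (¬a a)
𝟙-no (no _)  _  = refl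

𝟙-mono : {A B : Set} (a? : Dec A) (b? : Dec B) → (A → B) → 𝟙 a? ≤ℕ 𝟙 b?
𝟙-mono (yes a) b? f = ℕₚ.≤-reflexive (sym (𝟙-yes b? (f a)))
𝟙-mono (no _)  b? f = z≤n

𝟙-cong : {A B : Set} (a? : Dec A) (b? : Dec B) → (A → B) → (B → A) → 𝟙 a? ≡ 𝟙 b?
𝟙-cong a? b? f g = ℕₚ.≤-antisym (𝟙-mono a? b? f) (𝟙-mono b? a? g)

count : {N : ℕ} {P : Fin N → Set} → ((i : Fin N) → Dec (P i)) → ℕ
count {N} P? = ∑[ i < N ] 𝟙 (P? i)

∑-mono : ∀ {N} {f g : Fin N → ℕ} → (∀ i → f i ≤ℕ g i) → sum f ≤ℕ sum g
∑-mono {zero}  f≤g = z≤n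
∑-mono {suc N} f≤g = ℕₚ.+-mono-≤ (f≤g zero) (∑-mono (f≤g ∘ suc))

∑-↑ : ∀ m {n} (f : Fin (m +ℕ n) → ℕ) →
  sum f ≡ ∑[ i < m ] f (i ↑ˡ n) +ℕ ∑[ j < n ] f (m ↑ʳ j)
∑-↑ zero    f = refl
∑-↑ (suc m) f = trans (cong (f zero +ℕ_) (∑-↑ m (f ∘ suc))) (sym (ℕₚ.+-assoc (f zero) _ _))

∑-splitAt : ∀ m {n} (f : Fin m ⊎ Fin n → ℕ) →
  ∑[ k < m +ℕ n ] f (splitAt m k) ≡ ∑[ i < m ] f (inj₁ i) +ℕ ∑[ j < n ] f (inj₂ j)
∑-splitAt m {n} f = trans (∑-↑ m (f ∘ splitAt m)) (cong₂ _+ℕ_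
  (sum-cong-≗ (λ i → cong f (Finₚ.splitAt-↑ˡ m i n)))
  (sum-cong-≗ (λ j → cong f (Finₚ.splitAt-↑ʳ m n j))))

∑-remQuot : ∀ N W (f : Fin N × Fin W → ℕ) →
  ∑[ k < N *ℕ W ] f (remQuot W k) ≡ ∑[ i < N ] ∑[ c < W ] f (i , c)
∑-remQuot zero    W f = refl
∑-remQuot (suc N) W f = trans (∑-↑ W (f ∘ remQuot W)) (cong₂ _+ℕ_
  (sum-cong-≗ (λ c → cong f (Finₚ.remQuot-combine zero c)))
  (trans (sum-cong-≗ (λ k → cong f (first-suc k))) (∑-remQuot N W (λ (i , c) → f (suc i , c)))))
  where
  first-suc : ∀ k → remQuot {suc N} W (W ↑ʳ k) ≡ (suc (proj₁ (remQuot {N} W k)) , proj₂ (remQuot {N} W k))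
  first-suc k rewrite Finₚ.splitAt-↑ʳ W (N *ℕ W) k = refl

count-mono : ∀ {N} {P Q : Fin N → Set} (P? : ∀ i → Dec (P i)) (Q? : ∀ i → Dec (Q i)) →
  (∀ i → P i → Q i) → count P? ≤ℕ count Q?
count-mono P? Q? P⇒Q = ∑-mono (λ i → 𝟙-mono (P? i) (Q? i) (P⇒Q i))

count-cong : ∀ {N} {P Q : Fin N → Set} (P? : ∀ i → Dec (P i)) (Q? : ∀ i → Dec (Q i)) →
  (∀ i → P i → Q i) → (∀ i → Q i → P i) → count P? ≡ count Q?
count-cong P? Q? P⇒Q Q⇒P = ℕₚ.≤-antisym (count-mono P? Q? P⇒Q) (count-mono Q? P? Q⇒P)

∑-ones : ∀ N → ∑[ i < N ] 1 ≡ N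
∑-ones zero    = refl
∑-ones (suc N) = cong suc (∑-ones N)

module _ {N : ℕ} {P : Fin N → Set} (P? : ∀ i → Dec (P i)) where

  count≤N : count P? ≤ℕ N
  count≤N = subst (count P? ≤ℕ_) (∑-ones N) (∑-mono (λ i → 𝟙≤1 (P? i)))

  count-all : (∀ i → P i) → count P? ≡ N
  count-all all = trans (sum-cong-≗ (λ i → 𝟙-yes (P? i) (all i))) (∑-ones N)

  count-none : (∀ i → ¬ P i) → count P? ≡ 0
  count-none none = trans (sum-cong-≗ (λ i → 𝟙-no (P? i) (none i))) (sum-replicate-zero N)

count-pos⇒∃ : ∀ {N} {P : Fin N → Set} (P? : ∀ i → Dec (P i)) → 0 <ℕ count P? → ∃ P
count-pos⇒∃ {suc N} {P} P? = first (P? zero)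
  where
  first : (p₀? : Dec (P zero)) → 0 <ℕ 𝟙 p₀? +ℕ count (P? ∘ suc) → ∃ P
  first (yes p₀) _   = zero , p₀
  first (no _)   pos = let i , p = count-pos⇒∃ (P? ∘ suc) pos in suc i , p

∃⇒count-pos : ∀ {N} {P : Fin N → Set} (P? : ∀ i → Dec (P i)) → ∃ P → 0 <ℕ count P?
∃⇒count-pos {suc N} P? (zero  , p) = ℕₚ.≤-trans (ℕₚ.≤-reflexive (sym (𝟙-yes (P? zero) p))) (ℕₚ.m≤m+n _ _)
∃⇒count-pos {suc N} P? (suc i , p) = ℕₚ.≤-trans (∃⇒count-pos (P? ∘ suc) (i , p)) (ℕₚ.m≤n+m _ _)

count-≟ : ∀ {N} (j : Fin N) → count (λ i → i Fin.≟ j) ≡ 1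
count-≟ {suc N} zero    = cong suc (count-none (λ (i : Fin N) → suc i Fin.≟ zero) (λ i ()))
count-≟ {suc N} (suc j) = trans
  (count-cong (λ i → suc i Fin.≟ suc j) (λ i → i Fin.≟ j) (λ i → Finₚ.suc-injective) (λ i → cong suc))
  (count-≟ j)

count-splitAt : ∀ m {n} {P : Fin m ⊎ Fin n → Set} (P? : ∀ s → Dec (P s)) →
  count (λ k → P? (splitAt m k)) ≡ count (λ i → P? (inj₁ i)) +ℕ count (λ j → P? (inj₂ j))
count-splitAt m P? = ∑-splitAt m (λ s → 𝟙 (P? s))

-- Order statistics

length-filter-tabulate : ∀ {N} {P : ℤ → Set} (P? : ∀ z → Dec (P z)) (v : Fin N → ℤ) →
  length (filter P? (tabulate v)) ≡ count (λ i → P? (v i))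
length-filter-tabulate {zero}  P? v = refl
length-filter-tabulate {suc N} P? v with P? (v zero)
... | yes _ = cong suc (length-filter-tabulate P? (v ∘ suc))
... | no _  = length-filter-tabulate P? (v ∘ suc)

index1-∈ : ∀ xs k → k <ℕ length xs → index1 xs (suc k) ∈ xs
index1-∈ (x ∷ xs) zero    _         = here refl
index1-∈ (x ∷ xs) (suc k) (s≤s k<) = there (index1-∈ xs k k<)

length-filter-∷ : ∀ {P : ℤ → Set} (P? : ∀ z → Dec (P z)) x xs →
  length (filter P? (x ∷ xs)) ≡ 𝟙 (P? x) +ℕ length (filter P? xs)
length-filter-∷ P? x xs with P? x
... | yes _ = refl
... | no _  = refl

head≤all : ∀ {z zs} → Linked _≤_ (z ∷ zs) → All.All (z ≤_) (z ∷ zs)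
head≤all = Linkedₚ.Linked⇒All ℤₚ.≤-trans ℤₚ.≤-refl

sorted-count : ∀ {s} → Linked _≤_ s → ∀ k → k <ℕ length s →
  length (filter (_<? index1 s (suc k)) s) ≤ℕ k × suc k ≤ℕ length (filter (_≤? index1 s (suc k)) s)
sorted-count {z ∷ zs} sorted zero _ = none-below , head-upto
  where
  none-below : length (filter (_<? z) (z ∷ zs)) ≤ℕ 0
  none-below = ℕₚ.≤-reflexive (cong length (Listₚ.filter-none (_<? z) (All.map ℤₚ.≤⇒≯ (head≤all sorted))))
  head-upto : 1 ≤ℕ length (filter (_≤? z) (z ∷ zs))
  head-upto rewrite length-filter-∷ (_≤? z) z zs | 𝟙-yes (z ≤? z) ℤₚ.≤-refl = s≤s z≤n
sorted-count {z ∷ zs} sorted (suc k) (s≤s k<) with sorted-count (Linked.tail sorted) k k<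
... | below , upto = below′ , upto′
  where
  y = index1 zs (suc k)
  below′ : length (filter (_<? y) (z ∷ zs)) ≤ℕ suc k
  below′ rewrite length-filter-∷ (_<? y) z zs = ℕₚ.+-mono-≤ (𝟙≤1 (z <? y)) below
  upto′ : suc (suc k) ≤ℕ length (filter (_≤? y) (z ∷ zs))
  upto′ rewrite length-filter-∷ (_≤? y) z zs | 𝟙-yes (z ≤? y) (All.lookup (head≤all sorted) (there (index1-∈ zs k k<))) =
    s≤s upto

module _ {N : ℕ} (v : Fin N → ℤ) where

  private
    sorted-values = sort (tabulate v)

    count-sorted : ∀ {P : ℤ → Set} (P? : ∀ z → Dec (P z)) →
      length (filter P? sorted-values) ≡ count (λ i → P? (v i))
    count-sorted P? = trans (↭-length (filter-↭ P? (sort-↭ (tabulate v)))) (length-filter-tabulate P? v)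

    length-sorted : length sorted-values ≡ N
    length-sorted = trans (↭-length (sort-↭ (tabulate v))) (Listₚ.length-tabulate v)

  kth-count : ∀ k → k <ℕ N →
    count (λ i → v i <? kth (tabulate v) (suc k)) ≤ℕ k ×
    suc k ≤ℕ count (λ i → v i ≤? kth (tabulate v) (suc k))
  kth-count k k<N with sorted-count (sort-↗ (tabulate v)) k (subst (k <ℕ_) (sym length-sorted) k<N)
  ... | below , upto = subst (_≤ℕ k) (count-sorted _) below , subst (suc k ≤ℕ_) (count-sorted _) upto

  kth-∈ : ∀ k → k <ℕ N → ∃ λ i → kth (tabulate v) (suc k) ≡ v i
  kth-∈ k k<N = ∈-tabulate⁻ (∈-resp-↭ (sort-↭ (tabulate v))
    (index1-∈ sorted-values k (subst (k <ℕ_) (sym length-sorted) k<N)))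

  kth-All : ∀ {Q : ℤ → Set} k → k <ℕ N → (∀ i → Q (v i)) → Q (kth (tabulate v) (suc k))
  kth-All {Q} k k<N all with kth-∈ k k<N
  ... | i , kth≡vi = subst Q (sym kth≡vi) (all i)

  private
    count-≤-< : ∀ {a b} → a < b → count (λ i → v i ≤? a) ≤ℕ count (λ i → v i <? b)
    count-≤-< a<b = count-mono (λ i → v i ≤? _) (λ i → v i <? _) (λ i vi≤a → ℤₚ.≤-<-trans vi≤a a<b)

  kth≤⇔ : ∀ k t → k <ℕ N → (kth (tabulate v) (suc k) ≤ t) ⇔ (suc k ≤ℕ count (λ i → v i ≤? t))
  kth≤⇔ k t k<N = mk⇔
    (λ y≤t → ℕₚ.≤-trans (proj₂ (kth-count k k<N))
      (count-mono (λ i → v i ≤? _) (λ i → v i ≤? t) (λ i vi≤y → ℤₚ.≤-trans vi≤y y≤t)))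
    (λ upto → ℤₚ.≮⇒≥ (λ t<y → ℕₚ.<⇒≱ upto (ℕₚ.≤-trans (count-≤-< t<y) (proj₁ (kth-count k k<N)))))

  kth-unique : ∀ k w → count (λ i → v i <? w) ≤ℕ k → suc k ≤ℕ count (λ i → v i ≤? w) →
    kth (tabulate v) (suc k) ≡ w
  kth-unique k w below upto = ℤₚ.≤-antisym (Equivalence.from (kth≤⇔ k w k<N) upto)
    (ℤₚ.≮⇒≥ (λ y<w → ℕₚ.<⇒≱ (proj₂ (kth-count k k<N)) (ℕₚ.≤-trans (count-≤-< y<w) below)))
    where
    k<N = ℕₚ.<-≤-trans upto (count≤N _)

-- Lexicographic blocks

+-cancelˡ-≤ : ∀ z {x y} → z + x ≤ z + y → x ≤ y
+-cancelˡ-≤ z {x} {y} h = subst₂ _≤_ (\\-leftDividesʳ z x) (\\-leftDividesʳ z y) (ℤₚ.+-monoʳ-≤ (- z) h)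

+-cancelˡ-< : ∀ z {x y} → z + x < z + y → x < y
+-cancelˡ-< z {x} {y} h = subst₂ _<_ (\\-leftDividesʳ z x) (\\-leftDividesʳ z y) (ℤₚ.+-monoʳ-< (- z) h)

abs≤⇒bounds : ∀ {H s} → ∣ s ∣ ≤ℕ H → - (+ H) ≤ s × s ≤ + H
abs≤⇒bounds {H} {+ m}        h = ℤₚ.≤-trans ℤₚ.neg-≤-pos (+≤+ z≤n) , +≤+ h
abs≤⇒bounds {H} {ℤ.-[1+ m ]} h = ℤₚ.neg-mono-≤ (+≤+ h) , ℤₚ.≤-trans -≤+ (+≤+ z≤n)

lex-< : ∀ M {a b s t} → s < + M + t → a < b → + M * a + s < + M * b + t
lex-< M {a} {b} {s} {t} s<M+t a<b = begin-strict
  + M * a + s          <⟨ ℤₚ.+-monoʳ-< (+ M * a) s<M+t ⟩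
  + M * a + (+ M + t)  ≡⟨ shift (+ M) a t ⟩
  + M * (+ 1 + a) + t  ≤⟨ ℤₚ.+-monoˡ-≤ t (ℤₚ.*-monoˡ-≤-nonNeg (+ M) (ℤₚ.i<j⇒suc[i]≤j a<b)) ⟩
  + M * b + t          ∎
  where
  open ℤₚ.≤-Reasoning
  shift : ∀ m a t → m * a + (m + t) ≡ m * (+ 1 + a) + t
  shift = solve-∀-ℤ

scale : ℕ → ℤ
scale H = + suc (H +ℕ H)

module _ {H : ℕ} where

  scale-dominates : ∀ {s t} → ∣ s ∣ ≤ℕ H → ∣ t ∣ ≤ℕ H → s < scale H + t
  scale-dominates {s} {t} ∣s∣≤H ∣t∣≤H = begin-strict
    s                          ≤⟨ proj₂ (abs≤⇒bounds ∣s∣≤H) ⟩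
    + H                        <⟨ +<+ ℕₚ.≤-refl ⟩
    + suc H                    ≡⟨ //-rightDividesʳ (+ H) (+ suc H) ⟨
    scale H + - (+ H)          ≤⟨ ℤₚ.+-monoʳ-≤ (scale H) (proj₁ (abs≤⇒bounds {s = t} ∣t∣≤H)) ⟩
    scale H + t                ∎
    where open ℤₚ.≤-Reasoning

  scale-separates : ∀ {a b s t} → ∣ s ∣ ≤ℕ H → ∣ t ∣ ≤ℕ H → a < b → scale H * a + s < scale H * b + t
  scale-separates {s = s} {t} ∣s∣≤H ∣t∣≤H = lex-< (suc (H +ℕ H)) (scale-dominates {s} {t} ∣s∣≤H ∣t∣≤H)

  scale-injective : ∀ {a b s t} → ∣ s ∣ ≤ℕ H → ∣ t ∣ ≤ℕ H →
    scale H * a + s ≡ scale H * b + t → a ≡ b × s ≡ t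
  scale-injective {a} {b} {s} {t} ∣s∣≤H ∣t∣≤H eq with ℤₚ.<-cmp a b
  ... | tri< a<b _ _ = ⊥-elim (ℤₚ.<-irrefl eq (scale-separates {s = s} {t} ∣s∣≤H ∣t∣≤H a<b))
  ... | tri> _ _ b<a = ⊥-elim (ℤₚ.<-irrefl (sym eq) (scale-separates {s = t} {s} ∣t∣≤H ∣s∣≤H b<a))
  ... | tri≈ _ refl _ = refl , ∙-cancelˡ (scale H * a) _ _ eq

-- The two predicates (· < w) and (· ≤ w) counted in the characterisation of kth, treated uniformly.
record Comparison (_∼_ : ℤ → ℤ → Set) : Set where
  field
    _∼?_      : ∀ x y → Dec (x ∼ y)
    <⇒∼       : ∀ {x y} → x < y → x ∼ y
    >⇒≁       : ∀ {x y} → y < x → ¬ x ∼ y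
    +-monoʳ   : ∀ z {x y} → x ∼ y → (z + x) ∼ (z + y)
    +-cancelˡ : ∀ z {x y} → (z + x) ∼ (z + y) → x ∼ y

<-comparison : Comparison _<_
<-comparison = record
  { _∼?_ = _<?_ ; <⇒∼ = λ x<y → x<y ; >⇒≁ = ℤₚ.<-asym ; +-monoʳ = ℤₚ.+-monoʳ-< ; +-cancelˡ = +-cancelˡ-< }

≤-comparison : Comparison _≤_
≤-comparison = record
  { _∼?_ = _≤?_ ; <⇒∼ = ℤₚ.<⇒≤ ; >⇒≁ = ℤₚ.<⇒≱ ; +-monoʳ = ℤₚ.+-monoʳ-≤ ; +-cancelˡ = +-cancelˡ-≤ }

count-≤-injective : ∀ {N} (f : Fin N → ℤ) → (∀ {i j} → f i ≡ f j → i ≡ j) →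
  ∀ i → count (λ j → f j ≤? f i) ≤ℕ suc (count (λ j → f j <? f i))
count-≤-injective {N} f f-injective i = begin
  count (λ j → f j ≤? f i)
    ≤⟨ ∑-mono split ⟩
  ∑[ j < N ] (𝟙 (f j <? f i) +ℕ 𝟙 (j Fin.≟ i))
    ≡⟨ ∑-distrib-+ (λ j → 𝟙 (f j <? f i)) (λ j → 𝟙 (j Fin.≟ i)) ⟩
  count (λ j → f j <? f i) +ℕ count (λ j → j Fin.≟ i)
    ≡⟨ cong (count (λ j → f j <? f i) +ℕ_) (count-≟ i) ⟩
  count (λ j → f j <? f i) +ℕ 1
    ≡⟨ ℕₚ.+-comm _ 1 ⟩
  suc (count (λ j → f j <? f i)) ∎
  where
  open ℕₚ.≤-Reasoning
  split : ∀ j → 𝟙 (f j ≤? f i) ≤ℕ 𝟙 (f j <? f i) +ℕ 𝟙 (j Fin.≟ i)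
  split j with f j ≤? f i | f j <? f i
  ... | no _      | _     = z≤n
  ... | yes _     | yes _ = s≤s z≤n
  ... | yes fj≤fi | no fj≮fi =
    ℕₚ.≤-reflexive (sym (𝟙-yes (j Fin.≟ i) (f-injective (ℤₚ.≤-antisym fj≤fi (ℤₚ.≮⇒≥ fj≮fi)))))

module _ {p : ℕ} (v : Fin p → ℤ) where

  perturb : Fin p → ℤ
  perturb i = + p * v i + + toℕ i

  perturb-mono-< : ∀ {i j} → v i < v j → perturb i < perturb j
  perturb-mono-< {i} {j} = lex-< p (+<+ (ℕₚ.<-≤-trans (Finₚ.toℕ<n i) (ℕₚ.m≤m+n p (toℕ j))))

  perturb-reflects-≤ : ∀ {i j} → perturb i ≤ perturb j → v i ≤ v j
  perturb-reflects-≤ pi≤pj = ℤₚ.≮⇒≥ (λ vj<vi → ℤₚ.<⇒≱ (perturb-mono-< vj<vi) pi≤pj)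

  perturb-injective : ∀ {i j} → perturb i ≡ perturb j → i ≡ j
  perturb-injective {i} {j} eq with ℤₚ.<-cmp (v i) (v j)
  ... | tri< vi<vj _ _ = ⊥-elim (ℤₚ.<-irrefl eq (perturb-mono-< vi<vj))
  ... | tri> _ _ vj<vi = ⊥-elim (ℤₚ.<-irrefl (sym eq) (perturb-mono-< vj<vi))
  ... | tri≈ _ vi≡vj _ rewrite vi≡vj = Finₚ.toℕ-injective (ℤₚ.+-injective (∙-cancelˡ (+ p * v j) _ _ eq))

  rank-of-kth : ∀ r → r <ℕ p → ∃ λ i →
    count (λ j → perturb j <? perturb i) ≡ r × kth (tabulate v) (suc r) ≡ v i
  rank-of-kth r r<p with kth-∈ perturb r r<p
  ... | i , kth≡ = i , rank≡r , kth-unique v r (v i) below′ upto′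
    where
    below : count (λ j → perturb j <? perturb i) ≤ℕ r
    below = subst (λ w → count (λ j → perturb j <? w) ≤ℕ r) kth≡ (proj₁ (kth-count perturb r r<p))
    upto : suc r ≤ℕ count (λ j → perturb j ≤? perturb i)
    upto = subst (λ w → suc r ≤ℕ count (λ j → perturb j ≤? w)) kth≡ (proj₂ (kth-count perturb r r<p))
    rank≡r : count (λ j → perturb j <? perturb i) ≡ r
    rank≡r = ℕₚ.≤-antisym below (ℕ.s≤s⁻¹ (ℕₚ.≤-trans upto (count-≤-injective perturb perturb-injective i)))
    below′ : count (λ j → v j <? v i) ≤ℕ r
    below′ = ℕₚ.≤-trans (count-mono _ (λ j → perturb j <? perturb i) (λ j → perturb-mono-<)) below
    upto′ : suc r ≤ℕ count (λ j → v j ≤? v i)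
    upto′ = ℕₚ.≤-trans upto (count-mono (λ j → perturb j ≤? perturb i) _ (λ j → perturb-reflects-≤))

-- Since scale H exceeds the spread 2H of the entries, cells compare first by key, then by entry.
module Block {N W : ℕ} (H : ℕ)
  (key : Fin N → ℤ) (key-injective : ∀ {i j} → key i ≡ key j → i ≡ j)
  (entry : Fin N → Fin W → ℤ) (entry-bounded : ∀ i c → ∣ entry i c ∣ ≤ℕ H) where

  cell : Fin N × Fin W → ℤ
  cell (i , c) = scale H * key i + entry i c

  block : Fin (N *ℕ W) → ℤ
  block = cell ∘ remQuot W

  rank : Fin N → ℕ
  rank i = count (λ j → key j <? key i)

  module _ {_∼_ : ℤ → ℤ → Set} (cmp : Comparison _∼_) (i* : Fin N) {e : ℤ} (∣e∣≤H : ∣ e ∣ ≤ℕ H) where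
    open Comparison cmp

    private
      w = scale H * key i* + e
      C = count (λ c → entry i* c ∼? e)

    count-row : ∀ i → count (λ c → cell (i , c) ∼? w) ≡ 𝟙 (key i <? key i*) *ℕ W +ℕ 𝟙 (i Fin.≟ i*) *ℕ C
    count-row i with ℤₚ.<-cmp (key i) (key i*)
    ... | tri< ki<ki* _ _
      rewrite 𝟙-yes (key i <? key i*) ki<ki* | 𝟙-no (i Fin.≟ i*) (λ { refl → ℤₚ.<-irrefl refl ki<ki* }) =
      trans (count-all (λ c → cell (i , c) ∼? w) (λ c → <⇒∼ (scale-separates (entry-bounded i c) ∣e∣≤H ki<ki*)))
            (sym (trans (ℕₚ.+-identityʳ (1 *ℕ W)) (ℕₚ.*-identityˡ W)))
    ... | tri> _ _ ki*<ki
      rewrite 𝟙-no (key i <? key i*) (ℤₚ.<-asym ki*<ki) | 𝟙-no (i Fin.≟ i*) (λ { refl → ℤₚ.<-irrefl refl ki*<ki }) =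
      count-none (λ c → cell (i , c) ∼? w) (λ c → >⇒≁ (scale-separates ∣e∣≤H (entry-bounded i c) ki*<ki))
    ... | tri≈ _ ki≡ki* _ with key-injective ki≡ki*
    ... | refl rewrite 𝟙-no (key i <? key i) (ℤₚ.<-irrefl refl) | 𝟙-yes (i Fin.≟ i) refl =
      trans (count-cong (λ c → cell (i , c) ∼? w) (λ c → entry i c ∼? e)
                        (λ c → +-cancelˡ (scale H * key i)) (λ c → +-monoʳ (scale H * key i)))
            (sym (ℕₚ.+-identityʳ C))

    count-block : count (λ k → block k ∼? w) ≡ rank i* *ℕ W +ℕ C
    count-block = begin
      count (λ k → block k ∼? w)
        ≡⟨ ∑-remQuot N W (λ ic → 𝟙 (cell ic ∼? w)) ⟩
      ∑[ i < N ] count (λ c → cell (i , c) ∼? w)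
        ≡⟨ sum-cong-≗ count-row ⟩
      ∑[ i < N ] (𝟙 (key i <? key i*) *ℕ W +ℕ 𝟙 (i Fin.≟ i*) *ℕ C)
        ≡⟨ ∑-distrib-+ (λ i → 𝟙 (key i <? key i*) *ℕ W) (λ i → 𝟙 (i Fin.≟ i*) *ℕ C) ⟩
      ∑[ i < N ] (𝟙 (key i <? key i*) *ℕ W) +ℕ ∑[ i < N ] (𝟙 (i Fin.≟ i*) *ℕ C)
        ≡⟨ cong₂ _+ℕ_ (*-distribʳ-sum W (λ i → 𝟙 (key i <? key i*))) (*-distribʳ-sum C (λ i → 𝟙 (i Fin.≟ i*))) ⟨
      rank i* *ℕ W +ℕ count (λ i → i Fin.≟ i*) *ℕ C
        ≡⟨ cong (λ m → rank i* *ℕ W +ℕ m *ℕ C) (count-≟ i*) ⟩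
      rank i* *ℕ W +ℕ 1 *ℕ C
        ≡⟨ cong (rank i* *ℕ W +ℕ_) (ℕₚ.*-identityˡ C) ⟩
      rank i* *ℕ W +ℕ C ∎
      where open ≡-Reasoning

  kth-block : ∀ i* q → q <ℕ W →
    kth (tabulate block) (suc (rank i* *ℕ W +ℕ q)) ≡ scale H * key i* + kth (tabulate (entry i*)) (suc q)
  kth-block i* q q<W = kth-unique block _ _
    (subst (_≤ℕ offset +ℕ q) (sym (count-block <-comparison i* ∣e*∣≤H))
      (ℕₚ.+-monoʳ-≤ offset (proj₁ (kth-count (entry i*) q q<W))))
    (subst₂ _≤ℕ_ (ℕₚ.+-suc offset q) (sym (count-block ≤-comparison i* ∣e*∣≤H))
      (ℕₚ.+-monoʳ-≤ offset (proj₂ (kth-count (entry i*) q q<W))))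
    where
    offset = rank i* *ℕ W
    ∣e*∣≤H : ∣ kth (tabulate (entry i*)) (suc q) ∣ ≤ℕ H
    ∣e*∣≤H = kth-All (entry i*) {λ e → ∣ e ∣ ≤ℕ H} q q<W (entry-bounded i*)


infixl 6 _⊕_ _⊖_
infixl 7 _⊛_

-- Linear forms

_⊕_ : ∀ {n} → LinForm n → LinForm n → LinForm n
L ⊕ L′ = linForm (λ i → coeff L i + coeff L′ i) (const L + const L′)

_⊛_ : ∀ {n} → ℤ → LinForm n → LinForm n
a ⊛ L = linForm (λ i → a * coeff L i) (a * const L)

_⊖_ : ∀ {n} → LinForm n → LinForm n → LinForm n
L ⊖ L′ = L ⊕ -1ℤ ⊛ L′

⟨_⟩ : ∀ {n} → ℤ → LinForm n
⟨ c ⟩ = linForm (λ _ → 0ℤ) c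

sumFin-cong : ∀ n {f g : Fin n → ℤ} → (∀ i → f i ≡ g i) → sumFin n f ≡ sumFin n g
sumFin-cong zero    f≗g = refl
sumFin-cong (suc n) f≗g = cong₂ _+_ (f≗g zero) (sumFin-cong n (f≗g ∘ suc))

sumFin-+ : ∀ n (f g : Fin n → ℤ) → sumFin n (λ i → f i + g i) ≡ sumFin n f + sumFin n g
sumFin-+ zero    f g = refl
sumFin-+ (suc n) f g = trans (cong (_+_ (f zero + g zero)) (sumFin-+ n (f ∘ suc) (g ∘ suc)))
  (interchange (f zero) (g zero) (sumFin n (f ∘ suc)) (sumFin n (g ∘ suc)))

sumFin-* : ∀ n a (f : Fin n → ℤ) → sumFin n (λ i → a * f i) ≡ a * sumFin n f
sumFin-* zero    a f = sym (ℤₚ.*-zeroʳ a)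
sumFin-* (suc n) a f = trans (cong (_+_ (a * f zero)) (sumFin-* n a (f ∘ suc))) (sym (ℤₚ.*-distribˡ-+ a (f zero) _))

sumFin-zero : ∀ n → sumFin n (λ _ → 0ℤ) ≡ 0ℤ
sumFin-zero zero    = refl
sumFin-zero (suc n) = trans (ℤₚ.+-identityˡ _) (sumFin-zero n)

module _ {n : ℕ} (x : Input n) where

  eval-⊕ : ∀ L L′ → eval (L ⊕ L′) x ≡ eval L x + eval L′ x
  eval-⊕ L L′ = begin
    const L + const L′ + sumFin n (λ i → (coeff L i + coeff L′ i) * bit (x i))
      ≡⟨ cong (_+_ (const L + const L′)) (trans (sumFin-cong n (λ i → ℤₚ.*-distribʳ-+ (bit (x i)) (coeff L i) (coeff L′ i)))
                                               (sumFin-+ n _ _)) ⟩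
    const L + const L′ + (sumFin n (λ i → coeff L i * bit (x i)) + sumFin n (λ i → coeff L′ i * bit (x i)))
      ≡⟨ interchange (const L) (const L′) _ _ ⟩
    eval L x + eval L′ x ∎
    where open ≡-Reasoning

  eval-⊛ : ∀ a L → eval (a ⊛ L) x ≡ a * eval L x
  eval-⊛ a L = begin
    a * const L + sumFin n (λ i → a * coeff L i * bit (x i))
      ≡⟨ cong (_+_ (a * const L)) (trans (sumFin-cong n (λ i → ℤₚ.*-assoc a (coeff L i) (bit (x i)))) (sumFin-* n a _)) ⟩
    a * const L + a * sumFin n (λ i → coeff L i * bit (x i))
      ≡⟨ ℤₚ.*-distribˡ-+ a (const L) _ ⟨
    a * eval L x ∎
    where open ≡-Reasoning

  eval-⊖ : ∀ L L′ → eval (L ⊖ L′) x ≡ eval L x - eval L′ x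
  eval-⊖ L L′ = trans (eval-⊕ L (-1ℤ ⊛ L′)) (cong (_+_ (eval L x)) (trans (eval-⊛ -1ℤ L′) (ℤₚ.-1*i≡-i (eval L′ x))))

  eval-⟨⟩ : ∀ c → eval ⟨ c ⟩ x ≡ c
  eval-⟨⟩ c = trans (cong (_+_ c) (sumFin-zero n)) (ℤₚ.+-identityʳ c)

module _ {n : ℕ} where

  bounded-mono : ∀ {A B} {L : LinForm n} → A ≤ℕ B → CoeffBounded A L → CoeffBounded B L
  bounded-mono A≤B (coeff≤ , const≤) = (λ i → ℕₚ.≤-trans (coeff≤ i) A≤B) , ℕₚ.≤-trans const≤ A≤B

  bounded-⊕ : ∀ {A B} {L L′ : LinForm n} → CoeffBounded A L → CoeffBounded B L′ → CoeffBounded (A +ℕ B) (L ⊕ L′)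
  bounded-⊕ {L = L} {L′} (coeff≤ , const≤) (coeff′≤ , const′≤) =
    (λ i → ℕₚ.≤-trans (ℤₚ.∣i+j∣≤∣i∣+∣j∣ (coeff L i) (coeff L′ i)) (ℕₚ.+-mono-≤ (coeff≤ i) (coeff′≤ i))) ,
    ℕₚ.≤-trans (ℤₚ.∣i+j∣≤∣i∣+∣j∣ (const L) (const L′)) (ℕₚ.+-mono-≤ const≤ const′≤)

  bounded-⊛ : ∀ {B} a {L : LinForm n} → CoeffBounded B L → CoeffBounded (∣ a ∣ *ℕ B) (a ⊛ L)
  bounded-⊛ a {L} (coeff≤ , const≤) =
    (λ i → subst (_≤ℕ _) (sym (ℤₚ.abs-* a (coeff L i))) (ℕₚ.*-monoʳ-≤ ∣ a ∣ (coeff≤ i))) ,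
    subst (_≤ℕ _) (sym (ℤₚ.abs-* a (const L))) (ℕₚ.*-monoʳ-≤ ∣ a ∣ const≤)

  bounded-⊖ : ∀ {A B} {L L′ : LinForm n} → CoeffBounded A L → CoeffBounded B L′ → CoeffBounded (A +ℕ B) (L ⊖ L′)
  bounded-⊖ {B = B} {L} {L′} bL bL′ =
    bounded-⊕ {L = L} bL (subst (λ D → CoeffBounded D (-1ℤ ⊛ L′)) (ℕₚ.*-identityˡ B) (bounded-⊛ -1ℤ {L′} bL′))

  bounded-⟨⟩ : ∀ c → CoeffBounded {n} ∣ c ∣ ⟨ c ⟩
  bounded-⟨⟩ c = (λ _ → z≤n) , ℕₚ.≤-refl

  eval-bounded : ∀ {B} (L : LinForm n) (x : Input n) → CoeffBounded B L → ∣ eval L x ∣ ≤ℕ suc n *ℕ B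
  eval-bounded {B} L x (coeff≤ , const≤) = ℕₚ.≤-trans (ℤₚ.∣i+j∣≤∣i∣+∣j∣ (const L) _)
    (ℕₚ.+-mono-≤ const≤ (sum≤ n (λ i → coeff L i * bit (x i)) (λ i → term≤ (coeff L i) (x i) (coeff≤ i))))
    where
    term≤ : ∀ c b → ∣ c ∣ ≤ℕ B → ∣ c * bit b ∣ ≤ℕ B
    term≤ c true  ∣c∣≤B = subst (_≤ℕ B) (cong ∣_∣ (sym (ℤₚ.*-identityʳ c))) ∣c∣≤B
    term≤ c false _     = subst (_≤ℕ B) (cong ∣_∣ (sym (ℤₚ.*-zeroʳ c))) z≤n
    sum≤ : ∀ m (f : Fin m → ℤ) → (∀ i → ∣ f i ∣ ≤ℕ B) → ∣ sumFin m f ∣ ≤ℕ m *ℕ B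
    sum≤ zero    f f≤ = z≤n
    sum≤ (suc m) f f≤ =
      ℕₚ.≤-trans (ℤₚ.∣i+j∣≤∣i∣+∣j∣ (f zero) _) (ℕₚ.+-mono-≤ (f≤ zero) (sum≤ m (f ∘ suc) (f≤ ∘ suc)))

module _ {n p : ℕ} (L : Fin p → LinForm n) where

  keyForm : Fin p → LinForm n
  keyForm i = + p ⊛ L i ⊕ ⟨ + toℕ i ⟩

  eval-keyForm : ∀ x i → eval (keyForm i) x ≡ perturb (λ j → eval (L j) x) i
  eval-keyForm x i = trans (eval-⊕ x (+ p ⊛ L i) ⟨ + toℕ i ⟩)
    (cong₂ _+_ (eval-⊛ x (+ p) (L i)) (eval-⟨⟩ x (+ toℕ i)))

  module _ {W : ℕ} (E : ℕ) (entry : Fin p → Fin W → LinForm n) where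

    -- Entries with coefficients bounded by E take values in [−(n+1)E, (n+1)E] on {0,1}ⁿ.
    cellForm : Fin p × Fin W → LinForm n
    cellForm (i , c) = scale (suc n *ℕ E) ⊛ keyForm i ⊕ entry i c

    blockForms : Fin (p *ℕ W) → LinForm n
    blockForms = cellForm ∘ remQuot W

    eval-cellForm : ∀ x i c →
      eval (cellForm (i , c)) x ≡ scale (suc n *ℕ E) * perturb (λ j → eval (L j) x) i + eval (entry i c) x
    eval-cellForm x i c = trans (eval-⊕ x (scale (suc n *ℕ E) ⊛ keyForm i) (entry i c))
      (cong (_+ eval (entry i c) x)
        (trans (eval-⊛ x (scale (suc n *ℕ E)) (keyForm i)) (cong (scale (suc n *ℕ E) *_) (eval-keyForm x i))))

module Pivot {n p : ℕ} (L : Fin p → LinForm n) (x : Input n) (r : ℕ) (r<p : r <ℕ p) where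

  Lv : Fin p → ℤ
  Lv i = eval (L i) x

  private
    pivot-spec = rank-of-kth Lv r r<p

  pivot : Fin p
  pivot = proj₁ pivot-spec

  kth-pivot : kth (values L x) (suc r) ≡ Lv pivot
  kth-pivot = proj₂ (proj₂ pivot-spec)

  module _ {W : ℕ} (E : ℕ) (entry : Fin p → Fin W → LinForm n) (entry-bounded : ∀ i c → CoeffBounded E (entry i c)) where

    open Block (suc n *ℕ E) (perturb Lv) (perturb-injective Lv)
      (λ i c → eval (entry i c) x) (λ i c → eval-bounded (entry i c) x (entry-bounded i c))

    kth-blockForms : ∀ q → q <ℕ W →
      kth (values (blockForms L E entry) x) (suc (r *ℕ W +ℕ q)) ≡
      scale (suc n *ℕ E) * perturb Lv pivot + kth (values (entry pivot) x) (suc q)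
    kth-blockForms q q<W = begin
      kth (values (blockForms L E entry) x) (suc (r *ℕ W +ℕ q))
        ≡⟨ cong₂ kth (Listₚ.tabulate-cong (λ k → eval-cellForm L E entry x _ _))
                     (cong (λ m → suc (m *ℕ W +ℕ q)) (sym (proj₁ (proj₂ pivot-spec)))) ⟩
      kth (tabulate block) (suc (rank pivot *ℕ W +ℕ q))
        ≡⟨ kth-block pivot q q<W ⟩
      scale (suc n *ℕ E) * perturb Lv pivot + kth (values (entry pivot) x) (suc q) ∎
      where open ≡-Reasoning

blockBound : (n D P E : ℕ) → ℕ
blockBound n D P E = suc (H +ℕ H) *ℕ (P *ℕ D +ℕ P) +ℕ E
  where H = suc n *ℕ E

entryBound : ℕ → ℕ
entryBound D = D +ℕ D +ℕ 1

formBound : (n D P : ℕ) → ℕ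
formBound n D P = blockBound n D P (entryBound D)

module _ {n p P D : ℕ} (p≤P : p ≤ℕ P) (L : Fin p → LinForm n) (L-bounded : ∀ i → CoeffBounded D (L i)) where

  keyForm-bounded : ∀ i → CoeffBounded (P *ℕ D +ℕ P) (keyForm L i)
  keyForm-bounded i = bounded-mono {L = keyForm L i}
    (ℕₚ.+-mono-≤ (ℕₚ.*-monoˡ-≤ D p≤P) (ℕₚ.≤-trans (ℕₚ.<⇒≤ (Finₚ.toℕ<n i)) p≤P))
    (bounded-⊕ {L = + p ⊛ L i} (bounded-⊛ (+ p) {L i} (L-bounded i)) (bounded-⟨⟩ (+ toℕ i)))

  blockForms-bounded : ∀ {W E} (entry : Fin p → Fin W → LinForm n) → (∀ i c → CoeffBounded E (entry i c)) →
    ∀ k → CoeffBounded (blockBound n D P E) (blockForms L E entry k)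
  blockForms-bounded {W} {E} entry entry-bounded k =
    bounded-⊕ {L = scale (suc n *ℕ E) ⊛ keyForm L i}
      (bounded-⊛ (scale (suc n *ℕ E)) {keyForm L i} (keyForm-bounded i)) (entry-bounded i c)
    where
    i = proj₁ (remQuot {p} W k)
    c = proj₂ (remQuot {p} W k)

block-index< : ∀ {r p q W} → r <ℕ p → q <ℕ W → r *ℕ W +ℕ q <ℕ p *ℕ W
block-index< {r} {p} {q} {W} r<p q<W = begin-strict
  r *ℕ W +ℕ q    <⟨ ℕₚ.+-monoʳ-< (r *ℕ W) q<W ⟩
  r *ℕ W +ℕ W    ≡⟨ ℕₚ.+-comm (r *ℕ W) W ⟩
  suc r *ℕ W     ≤⟨ ℕₚ.*-monoˡ-≤ W r<p ⟩
  p *ℕ W         ∎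
  where open ℕₚ.≤-Reasoning

-- From kSTAT to labelled order statistics

gap≤-1⇔ : ∀ a b → (a - b + -1ℤ ≤ -1ℤ) ⇔ (a ≤ b)
gap≤-1⇔ a b = mk⇔
  (λ h → ℤₚ.i-j≤0⇒i≤j (subst (_≤ 0ℤ) (//-rightDividesˡ 1ℤ (a - b)) (ℤₚ.+-monoˡ-≤ 1ℤ h)))
  (λ a≤b → ℤₚ.+-monoˡ-≤ -1ℤ (ℤₚ.i≤j⇒i-j≤0 a≤b))

isZeroColumn : ∀ {m k} → Fin m ⊎ Fin k → Bool
isZeroColumn (inj₁ _) = false
isZeroColumn (inj₂ _) = true

module GapRows {n ℓ₁ ℓ₂ b D : ℕ}
  (L : Fin ℓ₁ → LinForm n) (L-bounded : ∀ i → CoeffBounded D (L i))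
  (R : Fin ℓ₂ → LinForm n) (R-bounded : ∀ j → CoeffBounded D (R j))
  (r : ℕ) (r<ℓ₁ : r <ℕ ℓ₁) (b<ℓ₂ : b <ℕ ℓ₂) where

  W : ℕ
  W = ℓ₂ +ℕ suc b

  E : ℕ
  E = entryBound D

  gapEntry : Fin ℓ₁ → Fin ℓ₂ ⊎ Fin (suc b) → LinForm n
  gapEntry i (inj₁ j) = R j ⊖ L i ⊕ ⟨ -1ℤ ⟩
  gapEntry i (inj₂ _) = ⟨ 0ℤ ⟩

  entries : Fin ℓ₁ → Fin W → LinForm n
  entries i c = gapEntry i (splitAt ℓ₂ c)

  entries-bounded : ∀ i c → CoeffBounded E (entries i c)
  entries-bounded i c = bounded (splitAt ℓ₂ c)
    where
    bounded : ∀ s → CoeffBounded E (gapEntry i s)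
    bounded (inj₁ j) = bounded-⊕ {L = R j ⊖ L i} (bounded-⊖ {L = R j} (R-bounded j) (L-bounded i)) (bounded-⟨⟩ -1ℤ)
    bounded (inj₂ _) = bounded-mono {L = ⟨ 0ℤ ⟩} z≤n (bounded-⟨⟩ 0ℤ)

  forms : Fin (ℓ₁ *ℕ W) → LinForm n
  forms = blockForms L E entries

  labels : Fin (ℓ₁ *ℕ W) → Bool
  labels k = isZeroColumn (splitAt ℓ₂ (proj₂ (remQuot {ℓ₁} W k)))

  b<W : b <ℕ W
  b<W = ℕₚ.m≤n+m (suc b) ℓ₂

  index : ℕ
  index = suc (r *ℕ W +ℕ b)

  module AtInput (x : Input n) where
    open Pivot L x r r<ℓ₁ public

    Rv : Fin ℓ₂ → ℤ
    Rv j = eval (R j) x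

    row : Fin W → ℤ
    row c = eval (entries pivot c) x

    e* : ℤ
    e* = kth (tabulate row) (suc b)

    count-row≤-1 : count (λ c → row c ≤? -1ℤ) ≡ count (λ j → Rv j ≤? Lv pivot)
    count-row≤-1 = begin
      count (λ c → row c ≤? -1ℤ)
        ≡⟨ count-splitAt ℓ₂ (λ s → eval (gapEntry pivot s) x ≤? -1ℤ) ⟩
      count (λ j → eval (gapEntry pivot (inj₁ j)) x ≤? -1ℤ) +ℕ count (λ t → eval (gapEntry pivot (inj₂ t)) x ≤? -1ℤ)
        ≡⟨ cong₂ _+ℕ_
             (count-cong (λ j → eval (gapEntry pivot (inj₁ j)) x ≤? -1ℤ) (λ j → Rv j ≤? Lv pivot)
               (λ j → Equivalence.to (entry≤-1⇔ j)) (λ j → Equivalence.from (entry≤-1⇔ j)))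
             (count-none (λ t → eval (gapEntry pivot (inj₂ t)) x ≤? -1ℤ)
               (λ t → ℤₚ.<⇒≱ (subst (-1ℤ <_) (sym (eval-⟨⟩ x 0ℤ)) ℤ.-<+))) ⟩
      count (λ j → Rv j ≤? Lv pivot) +ℕ 0
        ≡⟨ ℕₚ.+-identityʳ _ ⟩
      count (λ j → Rv j ≤? Lv pivot) ∎
      where
      open ≡-Reasoning
      entry≤-1⇔ : ∀ j → (eval (gapEntry pivot (inj₁ j)) x ≤ -1ℤ) ⇔ (Rv j ≤ Lv pivot)
      entry≤-1⇔ j = subst (λ v → (v ≤ -1ℤ) ⇔ (Rv j ≤ Lv pivot)) (sym eval-gap) (gap≤-1⇔ (Rv j) (Lv pivot))
        where
        eval-gap : eval (gapEntry pivot (inj₁ j)) x ≡ Rv j - Lv pivot + -1ℤ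
        eval-gap = trans (eval-⊕ x (R j ⊖ L pivot) ⟨ -1ℤ ⟩) (cong₂ _+_ (eval-⊖ x (R j) (L pivot)) (eval-⟨⟩ x -1ℤ))

    e*≤0 : e* ≤ 0ℤ
    e*≤0 = Equivalence.from (kth≤⇔ row b 0ℤ b<W) (begin
      suc b
        ≡⟨ count-all (λ t → eval (gapEntry pivot (inj₂ t)) x ≤? 0ℤ) zero≤0 ⟨
      count (λ t → eval (gapEntry pivot (inj₂ t)) x ≤? 0ℤ)
        ≤⟨ ℕₚ.m≤n+m _ (count (λ j → eval (gapEntry pivot (inj₁ j)) x ≤? 0ℤ)) ⟩
      count (λ j → eval (gapEntry pivot (inj₁ j)) x ≤? 0ℤ) +ℕ count (λ t → eval (gapEntry pivot (inj₂ t)) x ≤? 0ℤ)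
        ≡⟨ count-splitAt ℓ₂ (λ s → eval (gapEntry pivot s) x ≤? 0ℤ) ⟨
      count (λ c → row c ≤? 0ℤ) ∎)
      where
      open ℕₚ.≤-Reasoning
      zero≤0 : ∀ t → eval (gapEntry pivot (inj₂ t)) x ≤ 0ℤ
      zero≤0 t = ℤₚ.≤-reflexive (eval-⟨⟩ x 0ℤ)

    e*≡0⇔ : (e* ≡ 0ℤ) ⇔ (Lv pivot < kth (tabulate Rv) (suc b))
    e*≡0⇔ = mk⇔
      (λ e*≡0 → ℤₚ.≰⇒> λ ρ≤L* → ℤₚ.<⇒≱ (ℤ.-<+ {n = 0}) (subst (_≤ -1ℤ) e*≡0 (e*≤-1 ρ≤L*)))
      (λ L*<ρ → ℤₚ.≤-antisym e*≤0 (ℤₚ.i<j⇒suc[i]≤j (ℤₚ.≰⇒> λ e*≤-1 → ℤₚ.<⇒≱ L*<ρ (ρ≤L* e*≤-1))))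
      where
      e*≤-1 : kth (tabulate Rv) (suc b) ≤ Lv pivot → e* ≤ -1ℤ
      e*≤-1 ρ≤L* = Equivalence.from (kth≤⇔ row b -1ℤ b<W)
        (subst (suc b ≤ℕ_) (sym count-row≤-1) (Equivalence.to (kth≤⇔ Rv b (Lv pivot) b<ℓ₂) ρ≤L*))
      ρ≤L* : e* ≤ -1ℤ → kth (tabulate Rv) (suc b) ≤ Lv pivot
      ρ≤L* e*≤-1 = Equivalence.from (kth≤⇔ Rv b (Lv pivot) b<ℓ₂)
        (subst (suc b ≤ℕ_) count-row≤-1 (Equivalence.to (kth≤⇔ row b -1ℤ b<W) e*≤-1))

    LabelledHit : Set
    LabelledHit = Σ (Fin (ℓ₁ *ℕ W)) λ k → labels k ≡ true × kth (values forms x) index ≡ eval (forms k) x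

    private
      M : ℤ
      M = scale (suc n *ℕ E)

      K : Fin ℓ₁ → ℤ
      K = perturb Lv

      kth-forms : kth (values forms x) index ≡ M * K pivot + e*
      kth-forms = kth-blockForms E entries entries-bounded b b<W

      zero-column : ∀ i s → isZeroColumn s ≡ true → eval (gapEntry i s) x ≡ 0ℤ
      zero-column i (inj₂ _) _ = eval-⟨⟩ x 0ℤ

      ∣e*∣≤H : ∣ e* ∣ ≤ℕ suc n *ℕ E
      ∣e*∣≤H = kth-All row {λ e → ∣ e ∣ ≤ℕ suc n *ℕ E} b b<W
        (λ c → eval-bounded (entries pivot c) x (entries-bounded pivot c))

    hit⇒e*≡0 : LabelledHit → e* ≡ 0ℤ
    hit⇒e*≡0 (k , labelled , kth≡) =
      proj₂ (scale-injective {suc n *ℕ E} {K pivot} {K i} {e*} {0ℤ} ∣e*∣≤H z≤n (begin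
      M * K pivot + e*         ≡⟨ trans (sym kth-forms) kth≡ ⟩
      eval (forms k) x         ≡⟨ eval-cellForm L E entries x i c ⟩
      M * K i + eval (entries i c) x ≡⟨ cong (_+_ (M * K i)) (zero-column i (splitAt ℓ₂ c) labelled) ⟩
      M * K i + 0ℤ             ∎))
      where
      open ≡-Reasoning
      i = proj₁ (remQuot {ℓ₁} W k)
      c = proj₂ (remQuot {ℓ₁} W k)

    e*≡0⇒hit : e* ≡ 0ℤ → LabelledHit
    e*≡0⇒hit e*≡0 =
      k₀ , trans (cong (isZeroColumn ∘ splitAt ℓ₂ ∘ proj₂) k₀-cell) (cong isZeroColumn zero-column₀) , (begin
      kth (values forms x) index                   ≡⟨ trans kth-forms (cong (_+_ (M * K pivot)) e*≡0) ⟩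
      M * K pivot + 0ℤ                             ≡⟨ cong (_+_ (M * K pivot)) entry₀≡0 ⟨
      M * K pivot + eval (entries pivot c₀) x      ≡⟨ eval-cellForm L E entries x pivot c₀ ⟨
      eval (cellForm L E entries (pivot , c₀)) x   ≡⟨ cong (λ ic → eval (cellForm L E entries ic) x) k₀-cell ⟨
      eval (forms k₀) x                            ∎)
      where
      open ≡-Reasoning
      c₀ : Fin W
      c₀ = ℓ₂ ↑ʳ zero
      k₀ : Fin (ℓ₁ *ℕ W)
      k₀ = combine pivot c₀
      k₀-cell : remQuot W k₀ ≡ (pivot , c₀)
      k₀-cell = Finₚ.remQuot-combine pivot c₀
      zero-column₀ : splitAt ℓ₂ c₀ ≡ inj₂ zero
      zero-column₀ = Finₚ.splitAt-↑ʳ ℓ₂ (suc b) zero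
      entry₀≡0 : eval (entries pivot c₀) x ≡ 0ℤ
      entry₀≡0 = trans (cong (λ s → eval (gapEntry pivot s) x) zero-column₀) (eval-⟨⟩ x 0ℤ)

kstat⇒lab : ∀ {n D P} {f : Input n → Bool} →
  KStatRep n (CoeffBounded D) P f → LabRep n (CoeffBounded (formBound n D P)) (P *ℕ (P +ℕ P)) f
kstat⇒lab {n} {D} {P} {f}
  (ℓ₁ , ℓ₂ , ℓ₁+ℓ₂≤P , L , R , L-bounded , R-bounded , suc r , suc b , s≤s z≤n , r<ℓ₁ , s≤s z≤n , b<ℓ₂ , spec) =
  ℓ₁ *ℕ W , size≤ , forms , blockForms-bounded ℓ₁≤P L L-bounded entries entries-bounded ,
  index , s≤s z≤n , block-index< r<ℓ₁ b<W , labels , correct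
  where
  open GapRows L L-bounded R R-bounded r r<ℓ₁ b<ℓ₂
  ℓ₁≤P : ℓ₁ ≤ℕ P
  ℓ₁≤P = ℕₚ.≤-trans (ℕₚ.m≤m+n ℓ₁ ℓ₂) ℓ₁+ℓ₂≤P
  ℓ₂≤P : ℓ₂ ≤ℕ P
  ℓ₂≤P = ℕₚ.≤-trans (ℕₚ.m≤n+m ℓ₂ ℓ₁) ℓ₁+ℓ₂≤P
  size≤ : ℓ₁ *ℕ W ≤ℕ P *ℕ (P +ℕ P)
  size≤ = ℕₚ.*-mono-≤ ℓ₁≤P (ℕₚ.+-mono-≤ ℓ₂≤P (ℕₚ.≤-trans b<ℓ₂ ℓ₂≤P))
  correct : ∀ x → (f x ≡ true) ⇔ AtInput.LabelledHit x
  correct x = begin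
    f x ≡ true                                               ≈⟨ spec x ⟩
    kth (values L x) (suc r) < kth (values R x) (suc b)      ≡⟨ cong (_< kth (values R x) (suc b)) kth-pivot ⟩
    Lv pivot < kth (values R x) (suc b)                      ≈⟨ e*≡0⇔ ⟨
    e* ≡ 0ℤ                                                  ≈⟨ mk⇔ e*≡0⇒hit hit⇒e*≡0 ⟩
    LabelledHit                                              ∎
    where
    open Relation.Binary.Reasoning.Setoid (⇔-setoid 0ℓ)
    open AtInput x

-- From labelled order statistics to kSTAT

≤0⇔<1 : ∀ {e} → (e ≤ 0ℤ) ⇔ (e < 1ℤ)
≤0⇔<1 = mk⇔ (λ e≤0 → ℤₚ.≤-<-trans e≤0 (+<+ (s≤s z≤n))) <1⇒≤0
  where
  <1⇒≤0 : ∀ {e} → e < 1ℤ → e ≤ 0ℤ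
  <1⇒≤0 (+<+ (s≤s z≤n)) = +≤+ z≤n
  <1⇒≤0 ℤ.-<+          = -≤+

𝟙-≤+𝟙-≥ : ∀ a b → 𝟙 (a ≤? b) +ℕ 𝟙 (b ≤? a) ≡ suc (𝟙 (a ℤ.≟ b))
𝟙-≤+𝟙-≥ a b with ℤₚ.<-cmp a b
... | tri< a<b a≢b _
  rewrite 𝟙-yes (a ≤? b) (ℤₚ.<⇒≤ a<b) | 𝟙-no (b ≤? a) (ℤₚ.<⇒≱ a<b) | 𝟙-no (a ℤ.≟ b) a≢b = refl
... | tri> _ a≢b b<a
  rewrite 𝟙-no (a ≤? b) (ℤₚ.<⇒≱ b<a) | 𝟙-yes (b ≤? a) (ℤₚ.<⇒≤ b<a) | 𝟙-no (a ℤ.≟ b) a≢b = refl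
... | tri≈ _ refl _
  rewrite 𝟙-yes (a ≤? a) ℤₚ.≤-refl | 𝟙-yes (a ℤ.≟ a) refl = refl

module MatchRows {n p D : ℕ} (L : Fin p → LinForm n) (L-bounded : ∀ i → CoeffBounded D (L i)) (lab : Fin p → Bool)
  (r : ℕ) (r<p : r <ℕ p) where

  W : ℕ
  W = p +ℕ p

  E : ℕ
  E = entryBound D

  ≤-entry ≥-entry : Bool → LinForm n → LinForm n → LinForm n
  ≤-entry true  Li Lj = Li ⊖ Lj
  ≤-entry false _  _  = ⟨ 1ℤ ⟩
  ≥-entry true  Li Lj = Lj ⊖ Li
  ≥-entry false _  _  = ⟨ 0ℤ ⟩

  matchEntry : Fin p → Fin p ⊎ Fin p → LinForm n
  matchEntry i (inj₁ j) = ≤-entry (lab j) (L i) (L j)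
  matchEntry i (inj₂ j) = ≥-entry (lab j) (L i) (L j)

  entries : Fin p → Fin W → LinForm n
  entries i c = matchEntry i (splitAt p c)

  entries-bounded : ∀ i c → CoeffBounded E (entries i c)
  entries-bounded i c = bounded (splitAt p c)
    where
    D+D≤E = ℕₚ.m≤m+n (D +ℕ D) 1
    1≤E = ℕₚ.m≤n+m 1 (D +ℕ D)
    bounded : ∀ s → CoeffBounded E (matchEntry i s)
    bounded (inj₁ j) with lab j
    ... | true  = bounded-mono {L = L i ⊖ L j} D+D≤E (bounded-⊖ {L = L i} (L-bounded i) (L-bounded j))
    ... | false = bounded-mono {L = ⟨ 1ℤ ⟩} 1≤E (bounded-⟨⟩ 1ℤ)
    bounded (inj₂ j) with lab j
    ... | true  = bounded-mono {L = L j ⊖ L i} D+D≤E (bounded-⊖ {L = L j} (L-bounded j) (L-bounded i))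
    ... | false = bounded-mono {L = ⟨ 0ℤ ⟩} z≤n (bounded-⟨⟩ 0ℤ)

  ones : Fin p → Fin 1 → LinForm n
  ones _ _ = ⟨ 1ℤ ⟩

  ones-bounded : ∀ i c → CoeffBounded E (ones i c)
  ones-bounded _ _ = bounded-mono {L = ⟨ 1ℤ ⟩} (ℕₚ.m≤n+m 1 (D +ℕ D)) (bounded-⟨⟩ 1ℤ)

  leftForms : Fin (p *ℕ W) → LinForm n
  leftForms = blockForms L E entries

  rightForms : Fin (p *ℕ 1) → LinForm n
  rightForms = blockForms L E ones

  p<W : p <ℕ W
  p<W = ℕₚ.m<m+n p (ℕₚ.≤-trans (s≤s z≤n) r<p)

  leftIndex rightIndex : ℕ
  leftIndex  = suc (r *ℕ W +ℕ p)
  rightIndex = suc (r *ℕ 1 +ℕ 0)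

  module AtInput (x : Input n) where
    open Pivot L x r r<p public

    row : Fin W → ℤ
    row c = eval (entries pivot c) x

    e* : ℤ
    e* = kth (tabulate row) (suc p)

    Match : Fin p → Set
    Match j = lab j ≡ true × Lv pivot ≡ Lv j

    match? : ∀ j → Dec (Match j)
    match? j = (lab j Bool.≟ true) ×-dec (Lv pivot ℤ.≟ Lv j)

    private
      𝟙-diff≤0 : ∀ a b → 𝟙 (a - b ≤? 0ℤ) ≡ 𝟙 (a ≤? b)
      𝟙-diff≤0 a b = 𝟙-cong (a - b ≤? 0ℤ) (a ≤? b) ℤₚ.i-j≤0⇒i≤j ℤₚ.i≤j⇒i-j≤0

      𝟙-const≤0 : ∀ c → 𝟙 (eval ⟨ c ⟩ x ≤? 0ℤ) ≡ 𝟙 (c ≤? 0ℤ)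
      𝟙-const≤0 c = cong (λ v → 𝟙 (v ≤? 0ℤ)) (eval-⟨⟩ x c)

    column≤0 : ∀ β (Lj : LinForm n) →
      𝟙 (eval (≤-entry β (L pivot) Lj) x ≤? 0ℤ) +ℕ 𝟙 (eval (≥-entry β (L pivot) Lj) x ≤? 0ℤ)
      ≡ suc (𝟙 ((β Bool.≟ true) ×-dec (Lv pivot ℤ.≟ eval Lj x)))
    column≤0 true Lj = begin
      𝟙 (eval (L pivot ⊖ Lj) x ≤? 0ℤ) +ℕ 𝟙 (eval (Lj ⊖ L pivot) x ≤? 0ℤ)
        ≡⟨ cong₂ _+ℕ_ (trans (cong (λ v → 𝟙 (v ≤? 0ℤ)) (eval-⊖ x (L pivot) Lj)) (𝟙-diff≤0 (Lv pivot) (eval Lj x)))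
                      (trans (cong (λ v → 𝟙 (v ≤? 0ℤ)) (eval-⊖ x Lj (L pivot))) (𝟙-diff≤0 (eval Lj x) (Lv pivot))) ⟩
      𝟙 (Lv pivot ≤? eval Lj x) +ℕ 𝟙 (eval Lj x ≤? Lv pivot)
        ≡⟨ 𝟙-≤+𝟙-≥ (Lv pivot) (eval Lj x) ⟩
      suc (𝟙 (Lv pivot ℤ.≟ eval Lj x))
        ≡⟨ cong suc (𝟙-cong (Lv pivot ℤ.≟ eval Lj x) ((true Bool.≟ true) ×-dec (Lv pivot ℤ.≟ eval Lj x)) (refl ,_) proj₂) ⟩
      suc (𝟙 ((true Bool.≟ true) ×-dec (Lv pivot ℤ.≟ eval Lj x))) ∎
      where open ≡-Reasoning
    column≤0 false Lj = trans
      (cong₂ _+ℕ_ (trans (𝟙-const≤0 1ℤ) (𝟙-no (1ℤ ≤? 0ℤ) (ℤₚ.<⇒≱ (+<+ (s≤s z≤n)))))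
                  (trans (𝟙-const≤0 0ℤ) (𝟙-yes (0ℤ ≤? 0ℤ) ℤₚ.≤-refl)))
      (cong suc (sym (𝟙-no ((false Bool.≟ true) ×-dec (Lv pivot ℤ.≟ eval Lj x)) (λ { (() , _) }))))

    count-row≤0 : count (λ c → row c ≤? 0ℤ) ≡ p +ℕ count match?
    count-row≤0 = begin
      count (λ c → row c ≤? 0ℤ)
        ≡⟨ count-splitAt p (λ s → eval (matchEntry pivot s) x ≤? 0ℤ) ⟩
      ∑[ j < p ] 𝟙 (eval (≤-entry (lab j) (L pivot) (L j)) x ≤? 0ℤ)
        +ℕ ∑[ j < p ] 𝟙 (eval (≥-entry (lab j) (L pivot) (L j)) x ≤? 0ℤ)
        ≡⟨ ∑-distrib-+ (λ j → 𝟙 (eval (≤-entry (lab j) (L pivot) (L j)) x ≤? 0ℤ))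
                       (λ j → 𝟙 (eval (≥-entry (lab j) (L pivot) (L j)) x ≤? 0ℤ)) ⟨
      ∑[ j < p ] (𝟙 (eval (≤-entry (lab j) (L pivot) (L j)) x ≤? 0ℤ) +ℕ 𝟙 (eval (≥-entry (lab j) (L pivot) (L j)) x ≤? 0ℤ))
        ≡⟨ sum-cong-≗ (λ j → column≤0 (lab j) (L j)) ⟩
      ∑[ j < p ] (1 +ℕ 𝟙 (match? j))
        ≡⟨ ∑-distrib-+ (λ _ → 1) (λ j → 𝟙 (match? j)) ⟩
      ∑[ j < p ] 1 +ℕ count match?
        ≡⟨ cong (_+ℕ count match?) (∑-ones p) ⟩
      p +ℕ count match? ∎
      where open ≡-Reasoning

    e*≤0⇔ : (e* ≤ 0ℤ) ⇔ ∃ Match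
    e*≤0⇔ = mk⇔
      (λ e*≤0 → count-pos⇒∃ match? (ℕₚ.+-cancelˡ-≤ p 1 (count match?)
        (subst₂ _≤ℕ_ (ℕₚ.+-comm 1 p) count-row≤0 (Equivalence.to (kth≤⇔ row p 0ℤ p<W) e*≤0))))
      (λ match → Equivalence.from (kth≤⇔ row p 0ℤ p<W)
        (subst₂ _≤ℕ_ (ℕₚ.+-comm p 1) (sym count-row≤0) (ℕₚ.+-monoʳ-≤ p (∃⇒count-pos match? match))))

    M : ℤ
    M = scale (suc n *ℕ E)

    kth-leftForms : kth (values leftForms x) leftIndex ≡ M * perturb Lv pivot + e*
    kth-leftForms = kth-blockForms E entries entries-bounded p p<W

    kth-rightForms : kth (values rightForms x) rightIndex ≡ M * perturb Lv pivot + 1ℤ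
    kth-rightForms = trans (kth-blockForms E ones ones-bounded 0 (s≤s z≤n))
      (cong (_+_ (M * perturb Lv pivot)) (kth-All (λ c → eval (ones pivot c) x) {_≡ 1ℤ} 0 (s≤s z≤n) (λ _ → eval-⟨⟩ x 1ℤ)))

lab⇒kstat : ∀ {n D P} {f : Input n → Bool} →
  LabRep n (CoeffBounded D) P f →
  KStatRep n (CoeffBounded (formBound n D P)) (P *ℕ (P +ℕ P) +ℕ P *ℕ 1) f
lab⇒kstat {n} {D} {P} {f} (p , p≤P , L , L-bounded , suc r , s≤s z≤n , r<p , lab , spec) =
  p *ℕ W , p *ℕ 1 , size≤ , leftForms , rightForms ,
  blockForms-bounded p≤P L L-bounded entries entries-bounded , blockForms-bounded p≤P L L-bounded ones ones-bounded ,
  leftIndex , rightIndex , s≤s z≤n , block-index< r<p p<W , s≤s z≤n , block-index< r<p (s≤s z≤n) , correct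
  where
  open MatchRows L L-bounded lab r r<p
  size≤ : p *ℕ W +ℕ p *ℕ 1 ≤ℕ P *ℕ (P +ℕ P) +ℕ P *ℕ 1
  size≤ = ℕₚ.+-mono-≤ (ℕₚ.*-mono-≤ p≤P (ℕₚ.+-mono-≤ p≤P p≤P)) (ℕₚ.*-monoˡ-≤ 1 p≤P)
  correct : ∀ x → (f x ≡ true) ⇔ (kth (values leftForms x) leftIndex < kth (values rightForms x) rightIndex)
  correct x = begin
    f x ≡ true
      ≈⟨ spec x ⟩
    (Σ (Fin p) λ i → lab i ≡ true × kth (values L x) (suc r) ≡ eval (L i) x)
      ≡⟨ cong (λ v → Σ (Fin p) λ i → lab i ≡ true × v ≡ eval (L i) x) kth-pivot ⟩
    ∃ Match
      ≈⟨ e*≤0⇔ ⟨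
    e* ≤ 0ℤ
      ≈⟨ ≤0⇔<1 ⟩
    e* < 1ℤ
      ≈⟨ mk⇔ (ℤₚ.+-monoʳ-< (M * perturb Lv pivot)) (+-cancelˡ-< (M * perturb Lv pivot)) ⟩
    M * perturb Lv pivot + e* < M * perturb Lv pivot + 1ℤ
      ≡⟨ cong₂ _<_ kth-leftForms kth-rightForms ⟨
    kth (values leftForms x) leftIndex < kth (values rightForms x) rightIndex ∎
    where
    open Relation.Binary.Reasoning.Setoid (⇔-setoid 0ℓ)
    open AtInput x

-- Polynomial bounds

PolyBounded : (ℕ → ℕ) → Set
PolyBounded g = ∃ λ c → ∀ n → g n ≤ℕ poly c n

poly-zero : ∀ c → poly c 0 ≡ c
poly-zero zero    = refl
poly-zero (suc c) = cong (_+ℕ suc c) (ℕₚ.*-zeroʳ (suc c))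

module _ (m : ℕ) where

  private
    X = suc m

    scaled-pow-mono : ∀ c {k e} → k ≤ℕ e → c *ℕ X ^ k ≤ℕ c *ℕ X ^ e
    scaled-pow-mono c k≤e = ℕₚ.*-monoʳ-≤ c (ℕₚ.^-monoʳ-≤ X k≤e)

  poly-+-suc : ∀ a b → poly a X +ℕ poly b X ≤ℕ poly (a +ℕ b) X
  poly-+-suc a b = begin
    a *ℕ X ^ a +ℕ a +ℕ (b *ℕ X ^ b +ℕ b)
      ≤⟨ ℕₚ.+-mono-≤ (ℕₚ.+-monoˡ-≤ a (scaled-pow-mono a (ℕₚ.m≤m+n a b)))
                     (ℕₚ.+-monoˡ-≤ b (scaled-pow-mono b (ℕₚ.m≤n+m b a))) ⟩
    a *ℕ X ^ (a +ℕ b) +ℕ a +ℕ (b *ℕ X ^ (a +ℕ b) +ℕ b)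
      ≡⟨ collect a b (X ^ (a +ℕ b)) ⟩
    (a +ℕ b) *ℕ X ^ (a +ℕ b) +ℕ (a +ℕ b) ∎
    where
    open ℕₚ.≤-Reasoning
    collect : ∀ a b y → a *ℕ y +ℕ a +ℕ (b *ℕ y +ℕ b) ≡ (a +ℕ b) *ℕ y +ℕ (a +ℕ b)
    collect = solve-∀

  poly-*-suc : ∀ a b → poly a X *ℕ poly b X ≤ℕ poly (3 *ℕ (a *ℕ b) +ℕ (a +ℕ b)) X
  poly-*-suc a b = begin
    (a *ℕ X ^ a +ℕ a) *ℕ (b *ℕ X ^ b +ℕ b)
      ≡⟨ expand a b (X ^ a) (X ^ b) ⟩
    a *ℕ b *ℕ (X ^ a *ℕ X ^ b) +ℕ a *ℕ b *ℕ X ^ a +ℕ a *ℕ b *ℕ X ^ b +ℕ a *ℕ b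
      ≡⟨ cong (λ y → a *ℕ b *ℕ y +ℕ a *ℕ b *ℕ X ^ a +ℕ a *ℕ b *ℕ X ^ b +ℕ a *ℕ b) (ℕₚ.^-distribˡ-+-* X a b) ⟨
    a *ℕ b *ℕ X ^ (a +ℕ b) +ℕ a *ℕ b *ℕ X ^ a +ℕ a *ℕ b *ℕ X ^ b +ℕ a *ℕ b
      ≤⟨ ℕₚ.+-monoˡ-≤ (a *ℕ b) (ℕₚ.+-mono-≤ (ℕₚ.+-mono-≤
           (scaled-pow-mono (a *ℕ b) (ℕₚ.m≤n+m (a +ℕ b) (3 *ℕ (a *ℕ b))))
           (scaled-pow-mono (a *ℕ b) (ℕₚ.≤-trans (ℕₚ.m≤m+n a b) (ℕₚ.m≤n+m (a +ℕ b) (3 *ℕ (a *ℕ b))))))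
           (scaled-pow-mono (a *ℕ b) (ℕₚ.≤-trans (ℕₚ.m≤n+m b a) (ℕₚ.m≤n+m (a +ℕ b) (3 *ℕ (a *ℕ b)))))) ⟩
    a *ℕ b *ℕ X ^ e +ℕ a *ℕ b *ℕ X ^ e +ℕ a *ℕ b *ℕ X ^ e +ℕ a *ℕ b
      ≡⟨ gather (a *ℕ b) (X ^ e) ⟩
    3 *ℕ (a *ℕ b) *ℕ X ^ e +ℕ a *ℕ b
      ≤⟨ ℕₚ.+-mono-≤ (ℕₚ.*-monoˡ-≤ (X ^ e) (ℕₚ.m≤m+n (3 *ℕ (a *ℕ b)) (a +ℕ b)))
                     (ℕₚ.≤-trans (ℕₚ.m≤n*m (a *ℕ b) 3) (ℕₚ.m≤m+n (3 *ℕ (a *ℕ b)) (a +ℕ b))) ⟩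
    e *ℕ X ^ e +ℕ e ∎
    where
    open ℕₚ.≤-Reasoning
    e = 3 *ℕ (a *ℕ b) +ℕ (a +ℕ b)
    expand : ∀ a b y z →
      (a *ℕ y +ℕ a) *ℕ (b *ℕ z +ℕ b) ≡ a *ℕ b *ℕ (y *ℕ z) +ℕ a *ℕ b *ℕ y +ℕ a *ℕ b *ℕ z +ℕ a *ℕ b
    expand = solve-∀
    gather : ∀ c y → c *ℕ y +ℕ c *ℕ y +ℕ c *ℕ y +ℕ c ≡ 3 *ℕ c *ℕ y +ℕ c
    gather = solve-∀

poly-+ : ∀ a b n → poly a n +ℕ poly b n ≤ℕ poly (a +ℕ b) n
poly-+ a b zero rewrite poly-zero a | poly-zero b | poly-zero (a +ℕ b) = ℕₚ.≤-refl
poly-+ a b (suc m) = poly-+-suc m a b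

poly-* : ∀ a b n → poly a n *ℕ poly b n ≤ℕ poly (3 *ℕ (a *ℕ b) +ℕ (a +ℕ b)) n
poly-* a b zero rewrite poly-zero a | poly-zero b | poly-zero (3 *ℕ (a *ℕ b) +ℕ (a +ℕ b)) =
  ℕₚ.≤-trans (ℕₚ.m≤n*m (a *ℕ b) 3) (ℕₚ.m≤m+n (3 *ℕ (a *ℕ b)) (a +ℕ b))
poly-* a b (suc m) = poly-*-suc m a b

module _ {g h : ℕ → ℕ} where

  PolyBounded-+ : PolyBounded g → PolyBounded h → PolyBounded (λ n → g n +ℕ h n)
  PolyBounded-+ (a , g≤) (b , h≤) = a +ℕ b , λ n → ℕₚ.≤-trans (ℕₚ.+-mono-≤ (g≤ n) (h≤ n)) (poly-+ a b n)

  PolyBounded-* : PolyBounded g → PolyBounded h → PolyBounded (λ n → g n *ℕ h n)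
  PolyBounded-* (a , g≤) (b , h≤) =
    3 *ℕ (a *ℕ b) +ℕ (a +ℕ b) , λ n → ℕₚ.≤-trans (ℕₚ.*-mono-≤ (g≤ n) (h≤ n)) (poly-* a b n)

PolyBounded-const : ∀ k → PolyBounded (λ _ → k)
PolyBounded-const k = k , λ n → ℕₚ.m≤n+m k (k *ℕ n ^ k)

PolyBounded-id : PolyBounded (λ n → n)
PolyBounded-id = 1 , λ n →
  subst (_≤ℕ poly 1 n) (trans (ℕₚ.*-identityˡ (n ^ 1)) (ℕₚ.*-identityʳ n)) (ℕₚ.m≤m+n (1 *ℕ n ^ 1) 1)

PolyBounded-poly : ∀ c → PolyBounded (poly c)
PolyBounded-poly c = c , λ n → ℕₚ.≤-refl

upper-bound : ∀ {m} (f : Fin m → ℕ) → ∃ λ B → ∀ i → f i ≤ℕ B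
upper-bound {zero}  f = 0 , λ ()
upper-bound {suc m} f with upper-bound (f ∘ suc)
... | B , f∘suc≤B = f zero ⊔ B , λ
  { zero    → ℕₚ.m≤m⊔n (f zero) B
  ; (suc i) → ℕₚ.≤-trans (f∘suc≤B i) (ℕₚ.m≤n⊔m (f zero) B) }

linForm-bounded : ∀ {n} (L : LinForm n) → ∃ λ B → CoeffBounded B L
linForm-bounded L with upper-bound (∣_∣ ∘ coeff L)
... | B , coeff≤B = B ⊔ ∣ const L ∣ , (λ i → ℕₚ.≤-trans (coeff≤B i) (ℕₚ.m≤m⊔n B _)) , ℕₚ.m≤n⊔m B _

forms-bounded : ∀ {n m} (L : Fin m → LinForm n) → ∃ λ D → ∀ i → CoeffBounded D (L i)
forms-bounded L with upper-bound (proj₁ ∘ linForm-bounded ∘ L)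
... | D , B≤D = D , λ i → bounded-mono {L = L i} (B≤D i) (proj₂ (linForm-bounded (L i)))

module _ {n : ℕ} {Ok Ok′ : LinForm n → Set} {P P′ : ℕ} {f : Input n → Bool}
         (Ok⇒Ok′ : ∀ L → Ok L → Ok′ L) (P≤P′ : P ≤ℕ P′) where

  KStatRep-weaken : KStatRep n Ok P f → KStatRep n Ok′ P′ f
  KStatRep-weaken (ℓ₁ , ℓ₂ , ℓ≤P , L , R , L-ok , R-ok , rest) =
    ℓ₁ , ℓ₂ , ℕₚ.≤-trans ℓ≤P P≤P′ , L , R , (λ i → Ok⇒Ok′ (L i) (L-ok i)) , (λ j → Ok⇒Ok′ (R j) (R-ok j)) , rest

  LabRep-weaken : LabRep n Ok P f → LabRep n Ok′ P′ f
  LabRep-weaken (p , p≤P , L , L-ok , rest) = p , ℕₚ.≤-trans p≤P P≤P′ , L , (λ i → Ok⇒Ok′ (L i) (L-ok i)) , rest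

module _ {n : ℕ} {Ok : LinForm n → Set} {P : ℕ} {f : Input n → Bool} where

  KStatRep-bounded : KStatRep n Ok P f → ∃ λ D → KStatRep n (CoeffBounded D) P f
  KStatRep-bounded (ℓ₁ , ℓ₂ , ℓ≤P , L , R , _ , _ , rest) with forms-bounded L | forms-bounded R
  ... | D₁ , L-bounded | D₂ , R-bounded = D₁ ⊔ D₂ , ℓ₁ , ℓ₂ , ℓ≤P , L , R ,
    (λ i → bounded-mono {L = L i} (ℕₚ.m≤m⊔n D₁ D₂) (L-bounded i)) ,
    (λ j → bounded-mono {L = R j} (ℕₚ.m≤n⊔m D₁ D₂) (R-bounded j)) , rest

  LabRep-bounded : LabRep n Ok P f → ∃ λ D → LabRep n (CoeffBounded D) P f
  LabRep-bounded (p , p≤P , L , _ , rest) with forms-bounded L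
  ... | D , L-bounded = D , p , p≤P , L , L-bounded , rest

PolyBounded-formBound : ∀ {D P : ℕ → ℕ} → PolyBounded D → PolyBounded P → PolyBounded (λ n → formBound n (D n) (P n))
PolyBounded-formBound D-poly P-poly =
  PolyBounded-+ (PolyBounded-* S (PolyBounded-+ (PolyBounded-* P-poly D-poly) P-poly)) E
  where
  E = PolyBounded-+ (PolyBounded-+ D-poly D-poly) (PolyBounded-const 1)
  H = PolyBounded-* (PolyBounded-+ (PolyBounded-const 1) PolyBounded-id) E
  S = PolyBounded-+ (PolyBounded-const 1) (PolyBounded-+ H H)

PolyBounded-labSize : ∀ c → PolyBounded (λ n → poly c n *ℕ (poly c n +ℕ poly c n))
PolyBounded-labSize c = PolyBounded-* (PolyBounded-poly c) (PolyBounded-+ (PolyBounded-poly c) (PolyBounded-poly c))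

PolyBounded-kstatSize : ∀ c → PolyBounded (λ n → poly c n *ℕ (poly c n +ℕ poly c n) +ℕ poly c n *ℕ 1)
PolyBounded-kstatSize c = PolyBounded-+ (PolyBounded-labSize c) (PolyBounded-* (PolyBounded-poly c) (PolyBounded-const 1))

module _ {F : Family} where

  kSTAT⇒kSTATlab : kSTAT F → kSTATlab F
  kSTAT⇒kSTATlab (c , rep) = proj₁ size , λ n →
    LabRep-weaken (λ L (_ : CoeffBounded _ L) → tt) (proj₂ size n) (kstat⇒lab (proj₂ (KStatRep-bounded (rep n))))
    where size = PolyBounded-labSize c

  kSTATlab⇒kSTAT : kSTATlab F → kSTAT F
  kSTATlab⇒kSTAT (c , rep) = proj₁ size , λ n →
    KStatRep-weaken (λ L (_ : CoeffBounded _ L) → tt) (proj₂ size n) (lab⇒kstat (proj₂ (LabRep-bounded (rep n))))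
    where size = PolyBounded-kstatSize c

  kSTATpoly⇒kSTATlabPoly : kSTATpoly F → kSTATlabPoly F
  kSTATpoly⇒kSTATlabPoly (c , d , rep) = proj₁ size , proj₁ coeffs , λ n →
    LabRep-weaken (λ L → bounded-mono {L = L} (proj₂ coeffs n)) (proj₂ size n) (kstat⇒lab (rep n))
    where
    size = PolyBounded-labSize c
    coeffs = PolyBounded-formBound (PolyBounded-poly d) (PolyBounded-poly c)

  kSTATlabPoly⇒kSTATpoly : kSTATlabPoly F → kSTATpoly F
  kSTATlabPoly⇒kSTATpoly (c , d , rep) = proj₁ size , proj₁ coeffs , λ n →
    KStatRep-weaken (λ L → bounded-mono {L = L} (proj₂ coeffs n)) (proj₂ size n) (lab⇒kstat (rep n))
    where
    size = PolyBounded-kstatSize c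
    coeffs = PolyBounded-formBound (PolyBounded-poly d) (PolyBounded-poly c)

theorem5 : (F : Family) →
    (kSTAT F ⇔ kSTATlab F) × (kSTATpoly F ⇔ kSTATlabPoly F)
theorem5 F = mk⇔ kSTAT⇒kSTATlab kSTATlab⇒kSTAT , mk⇔ kSTATpoly⇒kSTATlabPoly kSTATlabPoly⇒kSTATpoly
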